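{- Let $x,y,z$ be elements of a group $G$ such that $\langle x,y\rangle$, $\langle x,z\rangle$ and $\langle y,z\rangle$ are cyclic. Then $\langle x,y,z\rangle$ is cyclic. -}

module Defs where

open import Level using (_⊔_)
open import Algebra.Bundles using (Group)
open import Data.List using (List; []; _∷_)
open import Data.List.Membership.Propositional using (_∈_)
open import Data.Product using (∃; _×_)

module _ {c ℓ} (G : Group c ℓ) where
  open Group G

  data Gen (S : List Carrier) : Carrier → Set (c ⊔ ℓ) where
    gen  : ∀ {a} → a ∈ S → Gen S a
    unit : Gen S ε
    mul  : ∀ {a b} → Gen S a → Gen S b → Gen S (a ∙ b)
    inv  : ∀ {a} → Gen S a → Gen S (a ⁻¹)
    resp : ∀ {a b} → a ≈ b → Gen S a → Gen S b

  IsCyclicGen : List Carrier → Set (c ⊔ ℓ)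
  IsCyclicGen S = ∃ λ g → Gen S g × (∀ h → Gen S h → Gen (g ∷ []) h)

-- Pairwise cyclicity makes x, y, z pairwise commuting. Write ⟨x, y⟩ = ⟨a⟩ with a = x^α y^β,
-- x = a^p₁, y = a^q₁ and α p₁ + β q₁ = 1; then ⟨x, y, z⟩ = ⟨a, z⟩. The cyclic groups ⟨x, z⟩ and
-- ⟨y, z⟩ give x^q₂ = z^p₂ and y^q₃ = z^p₃ with p₂ ⊥ q₂ and p₃ ⊥ q₃, so the kernel of the
-- homomorphism ℤ² → G, (m, n) ↦ a^m z^n, contains (p₁ q₂, −p₂) and (q₁ q₃, −p₃), whose four
-- entries generate ℤ. A lattice spanned by two such vectors contains a primitive vector (A, B);
-- completing it to a basis (A, B), (−σ, ρ) of ℤ² shows that a^−σ z^ρ generates ⟨a, z⟩.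
module Submission where

open import Algebra.Bundles using (Group)
open import Data.List using ([]; _∷_)
open import Data.List.Membership.Propositional using (_∈_)
open import Data.List.Relation.Unary.Any using (here; there)
import Relation.Binary.PropositionalEquality as P
open import Defs

module IntegerCoprimality where

  open import Data.Nat as ℕ using (ℕ; zero; suc)
  import Data.Nat.Properties as ℕ
  import Data.Nat.Divisibility as ℕ
  open import Data.Nat.Induction using (<-wellFounded)
  open import Data.Integer using (ℤ; +_; -[1+_]; 0ℤ; 1ℤ; ∣_∣; _+_; _*_; -_; _-_; _^_)
  open import Data.Integer.Properties
    using (abs-*; ∣i∣≡0⇒i≡0; *-identityˡ; *-identityʳ; *-assoc; *-comm; _≟_)
  open import Data.Integer.DivMod using (_/_; _%_; n%d<d; a≡a%n+[a/n]*n)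
  open import Data.Integer.Divisibility.Signed
    using ( _∣_; divides; ∣-refl; ∣-trans; ∣m∣n⇒∣m+n; ∣n⇒∣m*n; ∣m⇒∣m*n; ∣m+n∣m⇒∣n; ∣m+n∣n⇒∣m
          ; ∣⇒∣ᵤ; *-monoˡ-∣)
  open import Data.Integer.Tactic.RingSolver using (solve-∀)
  open import Data.Product using (∃; ∃₂; _,_)
  open import Induction.WellFounded using (Acc; acc)
  open import Relation.Nullary using (yes; no)
  open P using (_≡_; _≢_; refl; sym; trans; cong; cong₂; subst; ≢-sym; module ≡-Reasoning)
  open ≡-Reasoning

  -- Coprimality as a Bézout certificate, rather than the gcd-based notion of the library.
  Coprime : ℤ → ℤ → Set
  Coprime a b = ∃₂ λ ρ σ → ρ * a + σ * b ≡ 1ℤ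

  ∣i∣≡1⇒i*i≡1 : ∀ i → ∣ i ∣ ≡ 1 → i * i ≡ 1ℤ
  ∣i∣≡1⇒i*i≡1 (+ 1)     _ = refl
  ∣i∣≡1⇒i*i≡1 -[1+ 0 ] _ = refl
  ∣i∣≡1⇒i*i≡1 (+ 0) ()
  ∣i∣≡1⇒i*i≡1 (+ suc (suc _)) ()
  ∣i∣≡1⇒i*i≡1 -[1+ suc _ ] ()

  i∣1⇒i*i≡1 : ∀ {i} → i ∣ 1ℤ → i * i ≡ 1ℤ
  i∣1⇒i*i≡1 {i} i∣1 = ∣i∣≡1⇒i*i≡1 i (ℕ.∣1⇒≡1 (∣⇒∣ᵤ i∣1))

  coprime⇒common-divisor∣1 : ∀ {a b d} → Coprime a b → d ∣ a → d ∣ b → d ∣ 1ℤ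
  coprime⇒common-divisor∣1 (ρ , σ , eq) d∣a d∣b =
    subst (_ ∣_) eq (∣m∣n⇒∣m+n (∣n⇒∣m*n ρ d∣a) (∣n⇒∣m*n σ d∣b))

  coprime-∣ˡ : ∀ {a c d} → d ∣ a → Coprime a c → Coprime d c
  coprime-∣ˡ {d = d} (divides q refl) (ρ , σ , eq) =
    ρ * q , σ , trans (cong (_+ _) (*-assoc ρ q d)) eq

  coprime-∣-* : ∀ {k c} m → Coprime k c → k ∣ m * c → k ∣ m
  coprime-∣-* {k} {c} m (ρ , σ , eq) k∣mc =
    subst (k ∣_) m*[ρk+σc]≡m (∣m∣n⇒∣m+n (∣n⇒∣m*n (m * ρ) ∣-refl) (∣n⇒∣m*n σ k∣mc))
    where
    m*[ρk+σc]≡m : m * ρ * k + σ * (m * c) ≡ m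
    m*[ρk+σc]≡m = begin
      m * ρ * k + σ * (m * c) ≡⟨ distribute m ρ k σ c ⟩
      m * (ρ * k + σ * c)     ≡⟨ cong (m *_) eq ⟩
      m * 1ℤ                  ≡⟨ *-identityʳ m ⟩
      m                       ∎
      where
      distribute : ∀ m ρ k σ c → m * ρ * k + σ * (m * c) ≡ m * (ρ * k + σ * c)
      distribute = solve-∀

  coprime-∣-^ : ∀ {k b} m n → Coprime k b → k ∣ m * b ^ n → k ∣ m
  coprime-∣-^ {k} m zero    k⊥b k∣m = subst (k ∣_) (*-identityʳ m) k∣m
  coprime-∣-^ {k} {b} m (suc n) k⊥b k∣m =
    coprime-∣-* m k⊥b (coprime-∣-^ (m * b) n k⊥b (subst (k ∣_) (sym (*-assoc m b (b ^ n))) k∣m))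

  record GcdDecomposition (i j : ℤ) : Set where
    field
      d i′ j′ α β : ℤ
      i≡i′*d      : i ≡ i′ * d
      j≡j′*d      : j ≡ j′ * d
      bézout      : α * i′ + β * j′ ≡ 1ℤ

    d∣i : d ∣ i
    d∣i = divides i′ i≡i′*d

    d∣j : d ∣ j
    d∣j = divides j′ j≡j′*d

    combination : α * i + β * j ≡ d
    combination = begin
      α * i + β * j               ≡⟨ cong₂ (λ p q → α * p + β * q) i≡i′*d j≡j′*d ⟩
      α * (i′ * d) + β * (j′ * d) ≡⟨ factor α i′ d β j′ ⟩
      (α * i′ + β * j′) * d       ≡⟨ cong (_* d) bézout ⟩
      1ℤ * d                      ≡⟨ *-identityˡ d ⟩
      d                           ∎
      where
      factor : ∀ α i′ d β j′ → α * (i′ * d) + β * (j′ * d) ≡ (α * i′ + β * j′) * d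
      factor = solve-∀

    coprime-if-unit : d * d ≡ 1ℤ → Coprime i j
    coprime-if-unit d*d≡1 = d * α , d * β , (begin
      d * α * i + d * β * j ≡⟨ factor d α i β j ⟩
      d * (α * i + β * j)   ≡⟨ cong (d *_) combination ⟩
      d * d                 ≡⟨ d*d≡1 ⟩
      1ℤ                    ∎)
      where
      factor : ∀ d α i β j → d * α * i + d * β * j ≡ d * (α * i + β * j)
      factor = solve-∀

  gcdDecomposition-step : ∀ {i j r} q → i ≡ r + q * j → GcdDecomposition j r → GcdDecomposition i j
  gcdDecomposition-step {i} {j} {r} q i≡r+qj G = record
    { d = d ; i′ = r′ + q * j′ ; j′ = j′ ; α = β ; β = α - β * q
    ; i≡i′*d = i≡
    ; j≡j′*d = i≡i′*d
    ; bézout = trans (regroup α β q j′ r′) bézout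
    }
    where
    open GcdDecomposition G renaming (i′ to j′; j′ to r′; j≡j′*d to r≡r′*d)
    regroup : ∀ α β q j′ r′ → β * (r′ + q * j′) + (α - β * q) * j′ ≡ α * j′ + β * r′
    regroup = solve-∀
    i≡ : i ≡ (r′ + q * j′) * d
    i≡ = begin
      i                        ≡⟨ i≡r+qj ⟩
      r + q * j                ≡⟨ cong₂ (λ a b → a + q * b) r≡r′*d i≡i′*d ⟩
      r′ * d + q * (j′ * d)    ≡⟨ factor r′ d q j′ ⟩
      (r′ + q * j′) * d        ∎
      where
      factor : ∀ r′ d q j′ → r′ * d + q * (j′ * d) ≡ (r′ + q * j′) * d
      factor = solve-∀

  gcdDecomposition : ∀ i j → GcdDecomposition i j
  gcdDecomposition i j = euclid i j (<-wellFounded ∣ j ∣)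
    where
    euclid : ∀ i j → Acc ℕ._<_ ∣ j ∣ → GcdDecomposition i j
    euclid i (+ 0) _ = record
      { d = i ; i′ = 1ℤ ; j′ = 0ℤ ; α = 1ℤ ; β = 0ℤ
      ; i≡i′*d = sym (*-identityˡ i) ; j≡j′*d = refl ; bézout = refl }
    euclid i j@(+ suc _) (acc rs) =
      gcdDecomposition-step (i / j) (a≡a%n+[a/n]*n i j) (euclid j (+ (i % j)) (rs (n%d<d i j)))
    euclid i j@(-[1+ _ ]) (acc rs) =
      gcdDecomposition-step (i / j) (a≡a%n+[a/n]*n i j) (euclid j (+ (i % j)) (rs (n%d<d i j)))

  ∣i∣<∣i*j∣ : ∀ i j → i * j ≢ 0ℤ → ∣ j ∣ ≢ 1 → ∣ i ∣ ℕ.< ∣ i * j ∣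
  ∣i∣<∣i*j∣ i j i*j≢0 ∣j∣≢1 = subst (ℕ._<_ ∣ i ∣) (sym (abs-* i j)) (ℕ.m<m*n ∣ i ∣ ∣ j ∣ 1<∣j∣)
    where
    instance
      ∣i∣*∣j∣≢0 : ℕ.NonZero (∣ i ∣ ℕ.* ∣ j ∣)
      ∣i∣*∣j∣≢0 = ℕ.≢-nonZero (λ eq → i*j≢0 (∣i∣≡0⇒i≡0 (trans (abs-* i j) eq)))
      ∣i∣≢0 : ℕ.NonZero ∣ i ∣
      ∣i∣≢0 = ℕ.m*n≢0⇒m≢0 ∣ i ∣
      ∣j∣≢0 : ℕ.NonZero ∣ j ∣
      ∣j∣≢0 = ℕ.m*n≢0⇒n≢0 ∣ i ∣
    1<∣j∣ : 1 ℕ.< ∣ j ∣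
    1<∣j∣ = ℕ.≤∧≢⇒< (ℕ.n≢0⇒n>0 (ℕ.≢-nonZero⁻¹ ∣ j ∣)) (≢-sym ∣j∣≢1)

  -- Morally, part is the product of the prime powers of g at primes not dividing b.
  record CoprimePart (g b : ℤ) : Set where
    field
      part      : ℤ
      exponent  : ℕ
      part⊥b    : Coprime part b
      g∣part*bᵉ : g ∣ part * b ^ exponent

  coprimePart : ∀ {g} b → g ≢ 0ℤ → CoprimePart g b
  coprimePart {g} b g≢0 = go g g≢0 (<-wellFounded ∣ g ∣)
    where
    go : ∀ g → g ≢ 0ℤ → Acc ℕ._<_ ∣ g ∣ → CoprimePart g b
    go g g≢0 (acc rs) = from-gcd (gcdDecomposition g b)
      where
      from-gcd : GcdDecomposition g b → CoprimePart g b
      from-gcd G with ∣ GcdDecomposition.d G ∣ ℕ.≟ 1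
      ... | yes ∣d∣≡1 = record
        { part = g ; exponent = 0 ; part⊥b = coprime-if-unit (∣i∣≡1⇒i*i≡1 d ∣d∣≡1)
        ; g∣part*bᵉ = divides 1ℤ (*-comm g 1ℤ) }
        where open GcdDecomposition G
      ... | no ∣d∣≢1 = record
        { part = part ; exponent = suc exponent ; part⊥b = part⊥b
        ; g∣part*bᵉ = subst (_∣ part * b ^ suc exponent) (sym g≡g′*d)
                            (∣-trans (*-monoˡ-∣ d g∣part*bᵉ) (divides j′ regroup)) }
        where
        open GcdDecomposition G renaming (i′ to g′; i≡i′*d to g≡g′*d)
        g′*d≢0 : g′ * d ≢ 0ℤ
        g′*d≢0 g′*d≡0 = g≢0 (trans g≡g′*d g′*d≡0)
        ∣g′∣<∣g∣ : ∣ g′ ∣ ℕ.< ∣ g ∣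
        ∣g′∣<∣g∣ = subst (λ h → ∣ g′ ∣ ℕ.< ∣ h ∣) (sym g≡g′*d) (∣i∣<∣i*j∣ g′ d g′*d≢0 ∣d∣≢1)
        open CoprimePart (go g′ (λ g′≡0 → g′*d≢0 (cong (_* d) g′≡0)) (rs ∣g′∣<∣g∣))
        regroup : part * (b * b ^ exponent) ≡ j′ * (part * b ^ exponent * d)
        regroup = begin
          part * (b * b ^ exponent)       ≡⟨ cong (λ c → part * (c * b ^ exponent)) j≡j′*d ⟩
          part * (j′ * d * b ^ exponent)  ≡⟨ rearrange part j′ d (b ^ exponent) ⟩
          j′ * (part * b ^ exponent * d)  ∎
          where
          rearrange : ∀ p j′ d e → p * (j′ * d * e) ≡ j′ * (p * e * d)
          rearrange = solve-∀

  -- Take J to be the coprime part of g relative to b. Then k = gcd(g, b + J c) is coprime to b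
  -- (a common divisor of k and b divides J c and is coprime to c, so divides J ⊥ b); hence k
  -- divides J (as g ∣ J bᵉ), then b = (b + J c) − J c, and finally 1.
  coprime-shift-≢0 : ∀ {g b c} x y z → g ≢ 0ℤ → x * g + y * b + z * c ≡ 1ℤ →
                     ∃ λ J → Coprime g (b + J * c)
  coprime-shift-≢0 {g} {b} {c} x y z g≢0 eq = part , K.coprime-if-unit (i∣1⇒i*i≡1 k∣1)
    where
    open CoprimePart (coprimePart b g≢0)
    module K = GcdDecomposition (gcdDecomposition g (b + part * c))
    module D = GcdDecomposition (gcdDecomposition K.d b)

    d⊥c : Coprime D.d c
    d⊥c = coprime-∣ˡ (∣m∣n⇒∣m+n (∣n⇒∣m*n x (∣-trans D.d∣i K.d∣i)) (∣n⇒∣m*n y D.d∣j))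
                     (1ℤ , z , trans (cong (_+ z * c) (*-identityˡ (x * g + y * b))) eq)
    d∣part : D.d ∣ part
    d∣part = coprime-∣-* part d⊥c (∣m+n∣m⇒∣n (∣-trans D.d∣i K.d∣j) D.d∣j)
    k⊥b : Coprime K.d b
    k⊥b = D.coprime-if-unit (i∣1⇒i*i≡1 (coprime⇒common-divisor∣1 part⊥b d∣part D.d∣j))
    k∣part : K.d ∣ part
    k∣part = coprime-∣-^ part exponent k⊥b (∣-trans K.d∣i g∣part*bᵉ)
    k∣1 : K.d ∣ 1ℤ
    k∣1 = coprime⇒common-divisor∣1 k⊥b ∣-refl (∣m+n∣n⇒∣m K.d∣j (∣m⇒∣m*n c k∣part))

  coprime-shift : ∀ {g b c} x y z → x * g + y * b + z * c ≡ 1ℤ →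
                  ∃₂ λ κ J → Coprime (κ * g) (κ * b + J * c)
  coprime-shift {g} {b} {c} x y z eq with g ≟ 0ℤ
  ... | yes refl = y , z , 0ℤ , 1ℤ , trans (regroup x y z b c) eq
    where
    regroup : ∀ x y z b c → 0ℤ * (y * 0ℤ) + 1ℤ * (y * b + z * c) ≡ x * 0ℤ + y * b + z * c
    regroup = solve-∀
  ... | no g≢0 = with-κ≡1 (coprime-shift-≢0 x y z g≢0 eq)
    where
    with-κ≡1 : (∃ λ J → Coprime g (b + J * c)) → ∃₂ λ κ J → Coprime (κ * g) (κ * b + J * c)
    with-κ≡1 (J , ρ , σ , g⊥e) = 1ℤ , J , ρ , σ ,
      trans (cong₂ (λ p q → ρ * p + σ * (q + J * c)) (*-identityˡ g) (*-identityˡ b)) g⊥e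

  UnitContent : ℤ → ℤ → ℤ → ℤ → Set
  UnitContent A B C D = ∃₂ λ u v → ∃₂ λ w t → u * A + v * B + w * C + t * D ≡ 1ℤ

  -- With d = gcd(A, C), the unimodular row operation (α β ; −C′ A′) turns the rows (A, B), (C, D)
  -- into (d, b), (0, c); the content condition becomes x d + y b + z c = 1, and the shift
  -- lemma gives a primitive combination κ (d, b) + J (0, c).
  primitive-combination : ∀ {A B C D} → UnitContent A B C D →
                          ∃₂ λ l m → Coprime (l * A + m * C) (l * B + m * D)
  primitive-combination {A} {B} {C} {D} (u , v , w , t , eq) =
    combine (coprime-shift (u * A′ + w * C′) (v * A′ + t * C′) (t * α - v * β) content)
    where
    open GcdDecomposition (gcdDecomposition A C)
      renaming (i′ to A′; j′ to C′; i≡i′*d to A≡A′*d; j≡j′*d to C≡C′*d)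
    b = α * B + β * D
    c = A′ * D - C′ * B

    content : (u * A′ + w * C′) * d + (v * A′ + t * C′) * b + (t * α - v * β) * c ≡ 1ℤ
    content = begin
      (u * A′ + w * C′) * d + (v * A′ + t * C′) * b + (t * α - v * β) * c
        ≡⟨ expand u v w t d A′ C′ α β B D ⟩
      u * (A′ * d) + v * (B * (α * A′ + β * C′)) + w * (C′ * d) + t * (D * (α * A′ + β * C′))
        ≡⟨ cong₂ (λ p q → u * p + v * (B * (α * A′ + β * C′)) + w * q + t * (D * (α * A′ + β * C′)))
                 (sym A≡A′*d) (sym C≡C′*d) ⟩
      u * A + v * (B * (α * A′ + β * C′)) + w * C + t * (D * (α * A′ + β * C′))
        ≡⟨ cong (λ s → u * A + v * (B * s) + w * C + t * (D * s)) bézout ⟩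
      u * A + v * (B * 1ℤ) + w * C + t * (D * 1ℤ)
        ≡⟨ cong₂ (λ p q → u * A + v * p + w * C + t * q) (*-identityʳ B) (*-identityʳ D) ⟩
      u * A + v * B + w * C + t * D
        ≡⟨ eq ⟩
      1ℤ ∎
      where
      expand : ∀ u v w t d A′ C′ α β B D →
        (u * A′ + w * C′) * d + (v * A′ + t * C′) * (α * B + β * D) + (t * α - v * β) * (A′ * D - C′ * B)
        ≡ u * (A′ * d) + v * (B * (α * A′ + β * C′)) + w * (C′ * d) + t * (D * (α * A′ + β * C′))
      expand = solve-∀

    combine : (∃₂ λ κ J → Coprime (κ * d) (κ * b + J * c)) →
              ∃₂ λ l m → Coprime (l * A + m * C) (l * B + m * D)
    combine (κ , J , ρ , σ , prim) =
      l , m , ρ , σ , trans (cong₂ (λ p q → ρ * p + σ * q) first-row second-row) prim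
      where
      l = κ * α - J * C′
      m = κ * β + J * A′

      first-row : l * A + m * C ≡ κ * d
      first-row = begin
        l * A + m * C                   ≡⟨ cong₂ (λ p q → l * p + m * q) A≡A′*d C≡C′*d ⟩
        l * (A′ * d) + m * (C′ * d)     ≡⟨ collect κ α β J A′ C′ d ⟩
        κ * d * (α * A′ + β * C′)       ≡⟨ cong (κ * d *_) bézout ⟩
        κ * d * 1ℤ                      ≡⟨ *-identityʳ (κ * d) ⟩
        κ * d                           ∎
        where
        collect : ∀ κ α β J A′ C′ d →
          (κ * α - J * C′) * (A′ * d) + (κ * β + J * A′) * (C′ * d) ≡ κ * d * (α * A′ + β * C′)
        collect = solve-∀

      second-row : l * B + m * D ≡ κ * b + J * c
      second-row = collect κ α β J A′ C′ B D
        where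
        collect : ∀ κ α β J A′ C′ B D →
          (κ * α - J * C′) * B + (κ * β + J * A′) * D ≡ κ * (α * B + β * D) + J * (A′ * D - C′ * B)
        collect = solve-∀

  -- The ideal generated by the entries contains p₁ (as p₂ ⊥ q₂) and q₁ (as p₃ ⊥ q₃), which are coprime.
  unitContent-relations : ∀ {p₁ q₁ p₂ q₂ p₃ q₃} → Coprime p₁ q₁ → Coprime p₂ q₂ → Coprime p₃ q₃ →
                          UnitContent (p₁ * q₂) (- p₂) (q₁ * q₃) (- p₃)
  unitContent-relations {p₁} {q₁} {p₂} {q₂} {p₃} {q₃} (α₁ , β₁ , eq₁) (α₂ , β₂ , eq₂) (α₃ , β₃ , eq₃) =
    α₁ * β₂ , - (α₁ * α₂ * p₁) , β₁ * β₃ , - (β₁ * α₃ * q₁) , (begin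
      α₁ * β₂ * (p₁ * q₂) + - (α₁ * α₂ * p₁) * - p₂ + β₁ * β₃ * (q₁ * q₃) + - (β₁ * α₃ * q₁) * - p₃
        ≡⟨ regroup α₁ β₁ α₂ β₂ α₃ β₃ p₁ q₁ p₂ q₂ p₃ q₃ ⟩
      α₁ * p₁ * (α₂ * p₂ + β₂ * q₂) + β₁ * q₁ * (α₃ * p₃ + β₃ * q₃)
        ≡⟨ cong₂ (λ s t → α₁ * p₁ * s + β₁ * q₁ * t) eq₂ eq₃ ⟩
      α₁ * p₁ * 1ℤ + β₁ * q₁ * 1ℤ
        ≡⟨ cong₂ _+_ (*-identityʳ (α₁ * p₁)) (*-identityʳ (β₁ * q₁)) ⟩
      α₁ * p₁ + β₁ * q₁
        ≡⟨ eq₁ ⟩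
      1ℤ ∎)
    where
    regroup : ∀ α₁ β₁ α₂ β₂ α₃ β₃ p₁ q₁ p₂ q₂ p₃ q₃ →
      α₁ * β₂ * (p₁ * q₂) + - (α₁ * α₂ * p₁) * - p₂ + β₁ * β₃ * (q₁ * q₃) + - (β₁ * α₃ * q₁) * - p₃
      ≡ α₁ * p₁ * (α₂ * p₂ + β₂ * q₂) + β₁ * q₁ * (α₃ * p₃ + β₃ * q₃)
    regroup = solve-∀

module Subgroups {c ℓ} (G : Group c ℓ) where

  open import Data.Nat using (ℕ; zero; suc)
  open import Data.Integer using (ℤ; +_; -[1+_]; 0ℤ; 1ℤ; _+_; _*_; -_)
  import Data.Integer as ℤ
  import Data.Integer.Properties as ℤ
  open import Data.Integer.Tactic.RingSolver using (solve-∀)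
  open import Data.Product using (∃; ∃₂; _,_)
  open import Data.List.Membership.Propositional.Properties using (∈-++⁺ˡ)
  open import Function using (_∘_)
  open IntegerCoprimality
    using (Coprime; UnitContent; GcdDecomposition; gcdDecomposition; primitive-combination)

  open Group G
  open import Algebra.Properties.Group G using (inverseˡ-unique; loop)
  open import Algebra.Properties.Loop loop using (identityˡ-unique)
  open import Algebra.Properties.Monoid monoid using (ε-comm; insertˡ; insertʳ)
  open import Algebra.Properties.Semigroup semigroup using (uv≈wx⇒yu∙vz≈yw∙xz)
  open import Relation.Binary.Reasoning.Setoid setoid

  infixl 8 _^⁺_ _^_

  _^⁺_ : Carrier → ℕ → Carrier
  g ^⁺ zero  = ε
  g ^⁺ suc n = g ^⁺ n ∙ g

  _^_ : Carrier → ℤ → Carrier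
  g ^ (+ n)    = g ^⁺ n
  g ^ -[1+ n ] = g ⁻¹ ^⁺ suc n

  ^-suc : ∀ g k → g ^ ℤ.suc k ≈ g ^ k ∙ g
  ^-suc g (+ n)        = refl
  ^-suc g -[1+ zero ]  = insertʳ (inverseˡ g) ε
  ^-suc g -[1+ suc n ] = insertʳ (inverseˡ g) (g ⁻¹ ^⁺ suc n)

  ^-pred : ∀ g k → g ^ ℤ.pred k ≈ g ^ k ∙ g ⁻¹
  ^-pred g (+ zero)  = refl
  ^-pred g (+ suc n) = insertʳ (inverseʳ g) (g ^⁺ n)
  ^-pred g -[1+ n ]  = refl

  ^-+ : ∀ g m n → g ^ (m + n) ≈ g ^ m ∙ g ^ n
  ^-+ g m (+ zero) = begin
    g ^ (m + + 0)  ≡⟨ P.cong (g ^_) (ℤ.+-identityʳ m) ⟩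
    g ^ m          ≈⟨ identityʳ _ ⟨
    g ^ m ∙ ε      ∎
  ^-+ g m (+ suc n) = begin
    g ^ (m + + suc n)           ≡⟨ P.cong (g ^_) (ℤ.+-assoc m 1ℤ (+ n)) ⟨
    g ^ (m + 1ℤ + + n)          ≡⟨ P.cong (λ k → g ^ (k + + n)) (ℤ.+-comm m 1ℤ) ⟩
    g ^ (1ℤ + m + + n)          ≡⟨ P.cong (g ^_) (ℤ.+-assoc 1ℤ m (+ n)) ⟩
    g ^ ℤ.suc (m + + n)         ≈⟨ ^-suc g (m + + n) ⟩
    g ^ (m + + n) ∙ g           ≈⟨ ∙-congʳ (^-+ g m (+ n)) ⟩
    (g ^ m ∙ g ^ (+ n)) ∙ g     ≈⟨ assoc _ _ _ ⟩
    g ^ m ∙ g ^ (+ suc n)       ∎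
  ^-+ g m -[1+ zero ] = begin
    g ^ (m + -[1+ 0 ])          ≡⟨ P.cong (g ^_) (ℤ.+-comm m -[1+ 0 ]) ⟩
    g ^ ℤ.pred m                ≈⟨ ^-pred g m ⟩
    g ^ m ∙ g ⁻¹                ≈⟨ ∙-congˡ (identityˡ _) ⟨
    g ^ m ∙ g ^ -[1+ 0 ]        ∎
  ^-+ g m -[1+ suc n ] = begin
    g ^ (m + -[1+ suc n ])      ≡⟨ P.cong (g ^_) (ℤ.+-assoc m -[1+ 0 ] -[1+ n ]) ⟨
    g ^ (m + -[1+ 0 ] + -[1+ n ]) ≡⟨ P.cong (λ k → g ^ (k + -[1+ n ])) (ℤ.+-comm m -[1+ 0 ]) ⟩
    g ^ (-[1+ 0 ] + m + -[1+ n ]) ≡⟨ P.cong (g ^_) (ℤ.+-assoc -[1+ 0 ] m -[1+ n ]) ⟩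
    g ^ ℤ.pred (m + -[1+ n ])   ≈⟨ ^-pred g (m + -[1+ n ]) ⟩
    g ^ (m + -[1+ n ]) ∙ g ⁻¹   ≈⟨ ∙-congʳ (^-+ g m -[1+ n ]) ⟩
    (g ^ m ∙ g ^ -[1+ n ]) ∙ g ⁻¹ ≈⟨ assoc _ _ _ ⟩
    g ^ m ∙ g ^ -[1+ suc n ]    ∎

  ^-neg : ∀ g n → g ^ (- n) ≈ (g ^ n) ⁻¹
  ^-neg g n = inverseˡ-unique _ _ (begin
    g ^ (- n) ∙ g ^ n  ≈⟨ ^-+ g (- n) n ⟨
    g ^ (- n + n)      ≡⟨ P.cong (g ^_) (ℤ.+-inverseˡ n) ⟩
    ε                  ∎)

  ^⁺-congˡ : ∀ {u v} n → u ≈ v → u ^⁺ n ≈ v ^⁺ n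
  ^⁺-congˡ zero    u≈v = refl
  ^⁺-congˡ (suc n) u≈v = ∙-cong (^⁺-congˡ n u≈v) u≈v

  ^-congˡ : ∀ {u v} n → u ≈ v → u ^ n ≈ v ^ n
  ^-congˡ (+ n)      u≈v = ^⁺-congˡ n u≈v
  ^-congˡ -[1+ n ]   u≈v = ^⁺-congˡ (suc n) (⁻¹-cong u≈v)

  module _ (φ : ℤ → Carrier) (φ-+ : ∀ m n → φ (m + n) ≈ φ m ∙ φ n) where

    private
      φ-nonneg : ∀ n → φ (+ n) ≈ φ 1ℤ ^⁺ n
      φ-nonneg zero    = identityˡ-unique (φ 0ℤ) (φ 0ℤ) (sym (φ-+ 0ℤ 0ℤ))
      φ-nonneg (suc n) = begin
        φ (+ suc n)       ≡⟨ P.cong φ (ℤ.+-comm 1ℤ (+ n)) ⟩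
        φ (+ n + 1ℤ)      ≈⟨ φ-+ (+ n) 1ℤ ⟩
        φ (+ n) ∙ φ 1ℤ    ≈⟨ ∙-congʳ (φ-nonneg n) ⟩
        φ 1ℤ ^⁺ suc n     ∎

    additive⇒^ : ∀ n → φ n ≈ φ 1ℤ ^ n
    additive⇒^ (+ n)    = φ-nonneg n
    additive⇒^ -[1+ n ] = begin
      φ -[1+ n ]              ≈⟨ inverseˡ-unique _ _ φ[-n]∙φ[n]≈ε ⟩
      φ (+ suc n) ⁻¹          ≈⟨ ⁻¹-cong (φ-nonneg (suc n)) ⟩
      (φ 1ℤ ^ (+ suc n)) ⁻¹   ≈⟨ ^-neg (φ 1ℤ) (+ suc n) ⟨
      φ 1ℤ ^ -[1+ n ]         ∎
      where
      φ[-n]∙φ[n]≈ε : φ -[1+ n ] ∙ φ (+ suc n) ≈ ε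
      φ[-n]∙φ[n]≈ε = begin
        φ -[1+ n ] ∙ φ (+ suc n)   ≈⟨ φ-+ -[1+ n ] (+ suc n) ⟨
        φ (-[1+ n ] + + suc n)     ≡⟨ P.cong φ (ℤ.+-inverseˡ (+ suc n)) ⟩
        φ 0ℤ                       ≈⟨ φ-nonneg 0 ⟩
        ε                          ∎

  ^-* : ∀ g m n → g ^ (m * n) ≈ g ^ m ^ n
  ^-* g m n = begin
    g ^ (m * n)      ≈⟨ additive⇒^ (λ k → g ^ (m * k)) g^[m*_]-+ n ⟩
    g ^ (m * 1ℤ) ^ n ≡⟨ P.cong (λ k → g ^ k ^ n) (ℤ.*-identityʳ m) ⟩
    g ^ m ^ n        ∎
    where
    g^[m*_]-+ : ∀ k l → g ^ (m * (k + l)) ≈ g ^ (m * k) ∙ g ^ (m * l)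
    g^[m*_]-+ k l = trans (reflexive (P.cong (g ^_) (ℤ.*-distribˡ-+ m k l))) (^-+ g (m * k) (m * l))

  ε^ : ∀ n → ε ^ n ≈ ε
  ε^ n = sym (additive⇒^ (λ _ → ε) (λ _ _ → sym (identityʳ ε)) n)

  Commute : Carrier → Carrier → Set ℓ
  Commute u v = u ∙ v ≈ v ∙ u

  ^-commute-^ : ∀ g m n → Commute (g ^ m) (g ^ n)
  ^-commute-^ g m n = begin
    g ^ m ∙ g ^ n   ≈⟨ ^-+ g m n ⟨
    g ^ (m + n)     ≡⟨ P.cong (g ^_) (ℤ.+-comm m n) ⟩
    g ^ (n + m)     ≈⟨ ^-+ g n m ⟩
    g ^ n ∙ g ^ m   ∎

  Gen-^⁺ : ∀ {S g} n → Gen G S g → Gen G S (g ^⁺ n)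
  Gen-^⁺ zero    g∈ = unit
  Gen-^⁺ (suc n) g∈ = mul (Gen-^⁺ n g∈) g∈

  Gen-^ : ∀ {S g} n → Gen G S g → Gen G S (g ^ n)
  Gen-^ (+ n)    g∈ = Gen-^⁺ n g∈
  Gen-^ -[1+ n ] g∈ = Gen-^⁺ (suc n) (inv g∈)

  Gen-⊆ : ∀ {S T h} → (∀ {s} → s ∈ S → Gen G T s) → Gen G S h → Gen G T h
  Gen-⊆ S⊆T (gen s∈)   = S⊆T s∈
  Gen-⊆ S⊆T unit       = unit
  Gen-⊆ S⊆T (mul p q)  = mul (Gen-⊆ S⊆T p) (Gen-⊆ S⊆T q)
  Gen-⊆ S⊆T (inv p)    = inv (Gen-⊆ S⊆T p)
  Gen-⊆ S⊆T (resp e p) = resp e (Gen-⊆ S⊆T p)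

  Gen-[g]⇒^ : ∀ {g h} → Gen G (g ∷ []) h → ∃ λ n → h ≈ g ^ n
  Gen-[g]⇒^ {g} (gen (here P.refl)) = 1ℤ , sym (identityˡ g)
  Gen-[g]⇒^ unit = 0ℤ , refl
  Gen-[g]⇒^ {g} (mul p q) with Gen-[g]⇒^ p | Gen-[g]⇒^ q
  ... | m , u≈gᵐ | n , v≈gⁿ = m + n , trans (∙-cong u≈gᵐ v≈gⁿ) (sym (^-+ g m n))
  Gen-[g]⇒^ {g} (inv p) with Gen-[g]⇒^ p
  ... | m , u≈gᵐ = - m , trans (⁻¹-cong u≈gᵐ) (sym (^-neg g m))
  Gen-[g]⇒^ (resp u≈v p) with Gen-[g]⇒^ p
  ... | m , u≈gᵐ = m , trans (sym u≈v) u≈gᵐ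

  IsCyclicGen-transfer : ∀ {S T} → (∀ {s} → s ∈ S → Gen G T s) → (∀ {t} → t ∈ T → Gen G S t) →
                         IsCyclicGen G S → IsCyclicGen G T
  IsCyclicGen-transfer S⊆T T⊆S (g , g∈S , S⊆⟨g⟩) = g , Gen-⊆ S⊆T g∈S , λ h h∈T → S⊆⟨g⟩ h (Gen-⊆ T⊆S h∈T)

  Gen-commute : ∀ {S v w} → (∀ {s} → s ∈ S → Commute s v) → Gen G S w → Commute w v
  Gen-commute S⊥v (gen s∈) = S⊥v s∈
  Gen-commute {v = v} S⊥v unit = sym (ε-comm v)
  Gen-commute {v = v} S⊥v (mul {u} {w} p q) = begin
    (u ∙ w) ∙ v   ≈⟨ assoc u w v ⟩
    u ∙ (w ∙ v)   ≈⟨ ∙-congˡ (Gen-commute S⊥v q) ⟩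
    u ∙ (v ∙ w)   ≈⟨ assoc u v w ⟨
    (u ∙ v) ∙ w   ≈⟨ ∙-congʳ (Gen-commute S⊥v p) ⟩
    (v ∙ u) ∙ w   ≈⟨ assoc v u w ⟩
    v ∙ (u ∙ w)   ∎
  Gen-commute {v = v} S⊥v (inv {u} p) = begin
    u ⁻¹ ∙ v                  ≈⟨ ∙-congˡ (insertʳ (inverseʳ u) v) ⟩
    u ⁻¹ ∙ ((v ∙ u) ∙ u ⁻¹)   ≈⟨ ∙-congˡ (∙-congʳ (Gen-commute S⊥v p)) ⟨
    u ⁻¹ ∙ ((u ∙ v) ∙ u ⁻¹)   ≈⟨ ∙-congˡ (assoc u v (u ⁻¹)) ⟩
    u ⁻¹ ∙ (u ∙ (v ∙ u ⁻¹))   ≈⟨ insertˡ (inverseˡ u) (v ∙ u ⁻¹) ⟨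
    v ∙ u ⁻¹                  ∎
  Gen-commute {v = v} S⊥v (resp {u} {u′} u≈u′ p) = begin
    u′ ∙ v   ≈⟨ ∙-congʳ u≈u′ ⟨
    u ∙ v    ≈⟨ Gen-commute S⊥v p ⟩
    v ∙ u    ≈⟨ ∙-congˡ u≈u′ ⟩
    v ∙ u′   ∎

  ^-commute : ∀ {u v} n → Commute u v → Commute (u ^ n) v
  ^-commute {u} n u⊥v =
    Gen-commute {S = u ∷ []} (λ { (here P.refl) → u⊥v }) (Gen-^ n (gen (here P.refl)))

  relation-of-powers : ∀ {a u z} p q r → u ≈ a ^ p → u ^ q ≈ z ^ r → a ^ (p * q) ∙ z ^ (- r) ≈ ε
  relation-of-powers {a} {u} {z} p q r u≈aᵖ uᵠ≈zʳ = begin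
    a ^ (p * q) ∙ z ^ (- r)    ≈⟨ ∙-cong (^-* a p q) (^-neg z r) ⟩
    a ^ p ^ q ∙ (z ^ r) ⁻¹     ≈⟨ ∙-congʳ (^-congˡ q u≈aᵖ) ⟨
    u ^ q ∙ (z ^ r) ⁻¹         ≈⟨ ∙-congʳ uᵠ≈zʳ ⟩
    z ^ r ∙ (z ^ r) ⁻¹         ≈⟨ inverseʳ (z ^ r) ⟩
    ε                          ∎

  record CyclicPair (u v : Carrier) : Set ℓ where
    field
      α β p q : ℤ
      bézout  : α * p + β * q P.≡ 1ℤ
      u≈      : u ≈ (u ^ α ∙ v ^ β) ^ p
      v≈      : v ≈ (u ^ α ∙ v ^ β) ^ q

    generator : Carrier
    generator = u ^ α ∙ v ^ β

    generator∈ : Gen G (u ∷ v ∷ []) generator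
    generator∈ = mul (Gen-^ α (gen (here P.refl))) (Gen-^ β (gen (there (here P.refl))))

    coprime : Coprime p q
    coprime = α , β , bézout

    commute : Commute u v
    commute = begin
      u ∙ v                               ≈⟨ ∙-cong u≈ v≈ ⟩
      generator ^ p ∙ generator ^ q       ≈⟨ ^-commute-^ generator p q ⟩
      generator ^ q ∙ generator ^ p       ≈⟨ ∙-cong v≈ u≈ ⟨
      v ∙ u                               ∎

    generator-commute : ∀ {w} → Commute u w → Commute v w → Commute generator w
    generator-commute u⊥w v⊥w =
      Gen-commute (λ { (here P.refl) → u⊥w ; (there (here P.refl)) → v⊥w }) generator∈

    adjoin : ∀ {w} → IsCyclicGen G (generator ∷ w ∷ []) → IsCyclicGen G (u ∷ v ∷ w ∷ [])
    adjoin {w} = IsCyclicGen-transfer ⟨a,w⟩⊆⟨u,v,w⟩ ⟨u,v,w⟩⊆⟨a,w⟩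
      where
      ⟨a,w⟩⊆⟨u,v,w⟩ : ∀ {s} → s ∈ generator ∷ w ∷ [] → Gen G (u ∷ v ∷ w ∷ []) s
      ⟨a,w⟩⊆⟨u,v,w⟩ (here P.refl)        = Gen-⊆ (gen ∘ ∈-++⁺ˡ) generator∈
      ⟨a,w⟩⊆⟨u,v,w⟩ (there (here P.refl)) = gen (there (there (here P.refl)))

      ⟨u,v,w⟩⊆⟨a,w⟩ : ∀ {s} → s ∈ u ∷ v ∷ w ∷ [] → Gen G (generator ∷ w ∷ []) s
      ⟨u,v,w⟩⊆⟨a,w⟩ (here P.refl)                = resp (sym u≈) (Gen-^ p (gen (here P.refl)))
      ⟨u,v,w⟩⊆⟨a,w⟩ (there (here P.refl))        = resp (sym v≈) (Gen-^ q (gen (here P.refl)))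
      ⟨u,v,w⟩⊆⟨a,w⟩ (there (there (here P.refl))) = gen (there (here P.refl))

    u^q≈v^p : u ^ q ≈ v ^ p
    u^q≈v^p = begin
      u ^ q                  ≈⟨ ^-congˡ q u≈ ⟩
      generator ^ p ^ q      ≈⟨ ^-* generator p q ⟨
      generator ^ (p * q)    ≡⟨ P.cong (generator ^_) (ℤ.*-comm p q) ⟩
      generator ^ (q * p)    ≈⟨ ^-* generator q p ⟩
      generator ^ q ^ p      ≈⟨ ^-congˡ p v≈ ⟨
      v ^ p                  ∎

  cyclicPair : ∀ {u v} → IsCyclicGen G (u ∷ v ∷ []) → CyclicPair u v
  cyclicPair {u} {v} (g , _ , ⟨u,v⟩⊆⟨g⟩) =
    from-exponents (Gen-[g]⇒^ (⟨u,v⟩⊆⟨g⟩ u (gen (here P.refl))))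
                   (Gen-[g]⇒^ (⟨u,v⟩⊆⟨g⟩ v (gen (there (here P.refl)))))
    where
    from-exponents : (∃ λ i → u ≈ g ^ i) → (∃ λ j → v ≈ g ^ j) → CyclicPair u v
    from-exponents (i , u≈gⁱ) (j , v≈gʲ) = record
      { α = α ; β = β ; p = i′ ; q = j′ ; bézout = bézout
      ; u≈ = power-of-generator i i′ u≈gⁱ i≡i′*d ; v≈ = power-of-generator j j′ v≈gʲ j≡j′*d }
      where
      open GcdDecomposition (gcdDecomposition i j)
      generator≈gᵈ : u ^ α ∙ v ^ β ≈ g ^ d
      generator≈gᵈ = begin
        u ^ α ∙ v ^ β              ≈⟨ ∙-cong (^-congˡ α u≈gⁱ) (^-congˡ β v≈gʲ) ⟩
        g ^ i ^ α ∙ g ^ j ^ β      ≈⟨ ∙-cong (^-* g i α) (^-* g j β) ⟨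
        g ^ (i * α) ∙ g ^ (j * β)  ≈⟨ ^-+ g (i * α) (j * β) ⟨
        g ^ (i * α + j * β)        ≡⟨ P.cong (g ^_) (P.cong₂ _+_ (ℤ.*-comm i α) (ℤ.*-comm j β)) ⟩
        g ^ (α * i + β * j)        ≡⟨ P.cong (g ^_) combination ⟩
        g ^ d                      ∎
      power-of-generator : ∀ {w} k k′ → w ≈ g ^ k → k P.≡ k′ * d → w ≈ (u ^ α ∙ v ^ β) ^ k′
      power-of-generator {w} k k′ w≈gᵏ k≡k′d = begin
        w                        ≈⟨ w≈gᵏ ⟩
        g ^ k                    ≡⟨ P.cong (g ^_) (P.trans k≡k′d (ℤ.*-comm k′ d)) ⟩
        g ^ (d * k′)             ≈⟨ ^-* g d k′ ⟩
        g ^ d ^ k′               ≈⟨ ^-congˡ k′ generator≈gᵈ ⟨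
        (u ^ α ∙ v ^ β) ^ k′     ∎

  module CommutingPair {a z} (a⊥z : Commute a z) where

    ev : ℤ → ℤ → Carrier
    ev A B = a ^ A ∙ z ^ B

    ev-+ : ∀ A B C D → ev (A + C) (B + D) ≈ ev A B ∙ ev C D
    ev-+ A B C D = begin
      a ^ (A + C) ∙ z ^ (B + D)            ≈⟨ ∙-cong (^-+ a A C) (^-+ z B D) ⟩
      (a ^ A ∙ a ^ C) ∙ (z ^ B ∙ z ^ D)    ≈⟨ uv≈wx⇒yu∙vz≈yw∙xz aᶜ⊥zᴮ (a ^ A) (z ^ D) ⟩
      (a ^ A ∙ z ^ B) ∙ (a ^ C ∙ z ^ D)    ∎
      where
      aᶜ⊥zᴮ : Commute (a ^ C) (z ^ B)
      aᶜ⊥zᴮ = sym (^-commute B (sym (^-commute C a⊥z)))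

    ev-* : ∀ A B k → ev (k * A) (k * B) ≈ ev A B ^ k
    ev-* A B k = begin
      ev (k * A) (k * B)         ≈⟨ additive⇒^ (λ k → ev (k * A) (k * B)) ev-*-+ k ⟩
      ev (1ℤ * A) (1ℤ * B) ^ k   ≡⟨ P.cong₂ (λ A B → ev A B ^ k) (ℤ.*-identityˡ A) (ℤ.*-identityˡ B) ⟩
      ev A B ^ k                 ∎
      where
      ev-*-+ : ∀ k l → ev ((k + l) * A) ((k + l) * B) ≈ ev (k * A) (k * B) ∙ ev (l * A) (l * B)
      ev-*-+ k l = trans (reflexive (P.cong₂ ev (ℤ.*-distribʳ-+ A k l) (ℤ.*-distribʳ-+ B k l)))
                         (ev-+ (k * A) (k * B) (l * A) (l * B))

    ev-absorb : ∀ {A B} → ev A B ≈ ε → ∀ P Q n k → ev (n * P + k * A) (n * Q + k * B) ≈ ev P Q ^ n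
    ev-absorb {A} {B} rel P Q n k = begin
      ev (n * P + k * A) (n * Q + k * B)     ≈⟨ ev-+ (n * P) (n * Q) (k * A) (k * B) ⟩
      ev (n * P) (n * Q) ∙ ev (k * A) (k * B) ≈⟨ ∙-cong (ev-* P Q n) (ev-* A B k) ⟩
      ev P Q ^ n ∙ ev A B ^ k                 ≈⟨ ∙-congˡ (trans (^-congˡ k rel) (ε^ k)) ⟩
      ev P Q ^ n ∙ ε                          ≈⟨ identityʳ _ ⟩
      ev P Q ^ n                              ∎

    -- A relation (A, B) with ρ A + σ B = 1 is part of a basis of ℤ² whose other vector (−σ, ρ)
    -- then maps to a generator.
    primitive-relation⇒cyclic : ∀ A B → Coprime A B → ev A B ≈ ε → IsCyclicGen G (a ∷ z ∷ [])
    primitive-relation⇒cyclic A B (ρ , σ , bézout) rel =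
      h , mul (Gen-^ (- σ) (gen (here P.refl))) (Gen-^ ρ (gen (there (here P.refl)))) ,
      λ w → Gen-⊆ λ { (here P.refl) → resp (sym a≈hᴮ) (Gen-^ (- B) h∈⟨h⟩)
                    ; (there (here P.refl)) → resp (sym z≈hᴬ) (Gen-^ A h∈⟨h⟩) ; (there (there ())) }
      where
      h = ev (- σ) ρ
      h∈⟨h⟩ : Gen G (h ∷ []) h
      h∈⟨h⟩ = gen (here P.refl)
      a≈hᴮ : a ≈ h ^ (- B)
      a≈hᴮ = begin
        a                                           ≈⟨ trans (identityʳ _) (identityˡ a) ⟨
        ev 1ℤ 0ℤ                                    ≡⟨ P.cong₂ ev (P.trans (P.sym bézout) (first A B ρ σ)) (second B ρ) ⟩
        ev (- B * - σ + ρ * A) (- B * ρ + ρ * B)    ≈⟨ ev-absorb rel (- σ) ρ (- B) ρ ⟩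
        h ^ (- B)                                   ∎
        where
        first : ∀ A B ρ σ → ρ * A + σ * B P.≡ - B * - σ + ρ * A
        first = solve-∀
        second : ∀ B ρ → 0ℤ P.≡ - B * ρ + ρ * B
        second = solve-∀
      z≈hᴬ : z ≈ h ^ A
      z≈hᴬ = begin
        z                                           ≈⟨ trans (identityˡ _) (identityˡ z) ⟨
        ev 0ℤ 1ℤ                                    ≡⟨ P.cong₂ ev (first A σ) (P.trans (P.sym bézout) (second A B ρ σ)) ⟩
        ev (A * - σ + σ * A) (A * ρ + σ * B)        ≈⟨ ev-absorb rel (- σ) ρ A σ ⟩
        h ^ A                                       ∎
        where
        first : ∀ A σ → 0ℤ P.≡ A * - σ + σ * A
        first = solve-∀
        second : ∀ A B ρ σ → ρ * A + σ * B P.≡ A * ρ + σ * B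
        second = solve-∀

    relations-closed : ∀ {A B C D} l m → ev A B ≈ ε → ev C D ≈ ε → ev (l * A + m * C) (l * B + m * D) ≈ ε
    relations-closed l m rel₁ rel₂ = trans (ev-absorb rel₂ _ _ l m) (trans (^-congˡ l rel₁) (ε^ l))

  commuting-pair-cyclic : ∀ {a z A B C D} → Commute a z → UnitContent A B C D →
                          a ^ A ∙ z ^ B ≈ ε → a ^ C ∙ z ^ D ≈ ε → IsCyclicGen G (a ∷ z ∷ [])
  commuting-pair-cyclic {A = A} {B} {C} {D} a⊥z content rel₁ rel₂ =
    from-primitive (primitive-combination content)
    where
    open CommutingPair a⊥z
    from-primitive : (∃₂ λ l m → Coprime (l * A + m * C) (l * B + m * D)) → IsCyclicGen G _
    from-primitive (l , m , coprime) =
      primitive-relation⇒cyclic (l * A + m * C) (l * B + m * D) coprime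
        (relations-closed {A} {B} {C} {D} l m rel₁ rel₂)

mainTheorem20 : ∀ {c ℓ} (G : Group c ℓ) (x y z : Group.Carrier G) →
    IsCyclicGen G (x ∷ y ∷ []) → IsCyclicGen G (x ∷ z ∷ []) → IsCyclicGen G (y ∷ z ∷ []) →
    IsCyclicGen G (x ∷ y ∷ z ∷ [])
mainTheorem20 G x y z ⟨x,y⟩ ⟨x,z⟩ ⟨y,z⟩ =
  XY.adjoin (commuting-pair-cyclic (XY.generator-commute XZ.commute YZ.commute)
                                   (unitContent-relations XY.coprime XZ.coprime YZ.coprime)
                                   (relation-of-powers XY.p XZ.q XZ.p XY.u≈ XZ.u^q≈v^p)
                                   (relation-of-powers XY.q YZ.q YZ.p XY.v≈ YZ.u^q≈v^p))
  where
  open Subgroups G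
  open IntegerCoprimality using (unitContent-relations)
  module XY = CyclicPair (cyclicPair ⟨x,y⟩)
  module XZ = CyclicPair (cyclicPair ⟨x,z⟩)
  module YZ = CyclicPair (cyclicPair ⟨y,z⟩)
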